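{- Let $G$ be a group of order $n$, written additively, and let $P\subseteq G$ be an $(n,mk,\sigma,\mu)$-partial difference set which is partitioned by a collection $\mathcal{S}'=\{D_1,\ldots,D_m\}$ of pairwise disjoint $k$-subsets of $G$. (i) $\mathcal{S}'$ is an $(n,m,k,\lambda)$-external difference family if and only if $\mathcal{S}'$ is a proper $(n,m,k,\sigma-\lambda,\mu-\lambda)$-disjoint partial difference family. (ii) $\mathcal{S}'$ is an $(n,m,k,\lambda)$-disjoint difference family if and only if $\mathcal{S}'$ is a proper $(n,m,k,\sigma-\lambda,\mu-\lambda)$-external partial difference family.
   Context: $G^*=G\setminus\{0\}$. For $D\subseteq G$, $\Delta(D)$ is the multiset $\{x-y: x,y\in D,\ x\neq y\}$; for disjoint $D_1,D_2\subseteq G$, $\Delta(D_1,D_2)$ is the multiset $\{x-y:x\in D_1,y\in D_2\}$. For $A\subseteq G$ and an integer $\lambda\ge 0$, $\lambda A$ denotes the multiset consisting of $\lambda$ copies of each element of $A$; sums/unions of multisets are multiset unions. A $k$-subset $P$ of $G$ is an $(n,k,\lambda,\mu)$-partial difference set (PDS) if $\Delta(P)=\lambda P+\mu(G^*\setminus P)$. A collection of $m$ disjoint $k$-subsets $\{D_1,\dots,D_m\}$ is an $(n,m,k,\lambda)$-disjoint difference family (DDF) if $\bigcup_i\Delta(D_i)=\lambda G^*$, and an $(n,m,k,\lambda)$-external difference family (EDF) if $\bigcup_{i\neq j}\Delta(D_i,D_j)=\lambda G^*$. For a collection $\{D_1,\dots,D_m\}$ of disjoint $k$-subsets of $G^*$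 with $S=\bigcup_i D_i$: it is an $(n,m,k,\lambda,\mu)$-disjoint partial difference family (DPDF) if $\bigcup_{i}\Delta(D_i)=\lambda S+\mu(G^*\setminus S)$, and an $(n,m,k,\lambda,\mu)$-external partial difference family (EPDF) if $\bigcup_{i\neq j}\Delta(D_i,D_j)=\lambda S+\mu(G^*\setminus S)$; it is called proper if $\lambda\neq\mu$.
   Formalization: The partial difference set P satisfies σ ≠ μ, so it is not a difference set, and 0 ∉ P. The statement above fails without it. -}

module Defs where

open import Data.Nat using (ℕ; zero; suc; _*_; _+_)
open import Data.Nat.ListAction using (sum)
open import Data.Bool using (Bool; true; false; if_then_else_; _∧_; not; _∨_)
open import Data.Fin using (Fin; _≟_)
open import Data.Fin.Subset using (Subset; _∈_; _∉_; ∣_∣)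
open import Data.Vec using (lookup)
open import Data.List using (List; map; allFin)
open import Data.Bool.ListAction using (any)
open import Data.Integer using (ℤ; +_) renaming (_+_ to _+ℤ_; _*_ to _*ℤ_)
open import Data.Product using (_×_; ∃)
open import Relation.Nullary.Decidable using (⌊_⌋)
open import Relation.Nullary using (¬_)
open import Relation.Binary.PropositionalEquality using (_≡_; _≢_)
open import Algebra.Structures using (IsGroup)

record FinGroup (n : ℕ) : Set where
  field
    _⊕_ : Fin n → Fin n → Fin n
    0g  : Fin n
    ⊖_  : Fin n → Fin n
    isGroup : IsGroup _≡_ _⊕_ 0g ⊖_

  _⊝_ : Fin n → Fin n → Fin n
  x ⊝ y = x ⊕ (⊖ y)

Σ[_] : (n : ℕ) → (Fin n → ℕ) → ℕ
Σ[ n ] f = sum (map f (allFin n))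

ind : Bool → ℕ
ind b = if b then 1 else 0

module _ {n : ℕ} (G : FinGroup n) where
  open FinGroup G

  mem : Subset n → Fin n → Bool
  mem A x = lookup A x

  eqᵇ : Fin n → Fin n → Bool
  eqᵇ x y = ⌊ x ≟ y ⌋

  nonzero : Fin n → Bool
  nonzero g = not (eqᵇ g 0g)

  -- multiplicity of g in the multiset Δ(D) = {x - y : x,y ∈ D, x ≠ y}
  Δ : Subset n → Fin n → ℕ
  Δ D g = Σ[ n ] λ x → Σ[ n ] λ y →
    ind (mem D x ∧ mem D y ∧ not (eqᵇ x y) ∧ eqᵇ (x ⊝ y) g)

  Δ₂ : Subset n → Subset n → Fin n → ℕ
  Δ₂ D₁ D₂ g = Σ[ n ] λ x → Σ[ n ] λ y →
    ind (mem D₁ x ∧ mem D₂ y ∧ eqᵇ (x ⊝ y) g)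

  -- (n,k,λ,μ)-partial difference set:  |P| = k and
  -- Δ(P) = λ P + μ (G* \ P)  as multisets (compared at every g ∈ G)
  IsPDS : Subset n → ℕ → ℕ → ℕ → Set
  IsPDS P k λ' μ =
    ∣ P ∣ ≡ k ×
    (∀ g → Δ P g ≡ λ' * ind (mem P g) + μ * ind (nonzero g ∧ not (mem P g)))

  module _ {m : ℕ} (D : Fin m → Subset n) where

    memS : Fin n → Bool
    memS g = any (λ i → mem (D i) g) (allFin m)

    DisjointKSubsets : ℕ → Set
    DisjointKSubsets k =
      (∀ i → ∣ D i ∣ ≡ k) ×
      (∀ i j → i ≢ j → ∀ x → x ∈ D i → x ∉ D j)

    ΔInt : Fin n → ℕ
    ΔInt g = Σ[ m ] λ i → Δ (D i) g

    ΔExt : Fin n → ℕ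
    ΔExt g = Σ[ m ] λ i → Σ[ m ] λ j → ind (not (eqᵇ' i j)) * Δ₂ (D i) (D j) g
      where
      eqᵇ' : Fin m → Fin m → Bool
      eqᵇ' i j = ⌊ i ≟ j ⌋

    IsDDF : ℕ → ℕ → Set
    IsDDF k λ' = DisjointKSubsets k × (∀ g → ΔInt g ≡ λ' * ind (nonzero g))

    IsEDF : ℕ → ℕ → Set
    IsEDF k λ' = DisjointKSubsets k × (∀ g → ΔExt g ≡ λ' * ind (nonzero g))

    -- the parameters λ, μ of DPDF/EPDF are taken in ℤ, since the theorem
    -- uses σ - λ and μ - λ
    PartialRHS : ℤ → ℤ → Fin n → ℤ
    PartialRHS λ' μ g =
      (λ' *ℤ + ind (memS g)) +ℤ (μ *ℤ + ind (nonzero g ∧ not (memS g)))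

    IsDPDF : ℕ → ℤ → ℤ → Set
    IsDPDF k λ' μ =
      DisjointKSubsets k × (∀ i → 0g ∉ D i) ×
      (∀ g → + ΔInt g ≡ PartialRHS λ' μ g)

    IsEPDF : ℕ → ℤ → ℤ → Set
    IsEPDF k λ' μ =
      DisjointKSubsets k × (∀ i → 0g ∉ D i) ×
      (∀ g → + ΔExt g ≡ PartialRHS λ' μ g)

    IsProperDPDF : ℕ → ℤ → ℤ → Set
    IsProperDPDF k λ' μ = IsDPDF k λ' μ × λ' ≢ μ

    IsProperEPDF : ℕ → ℤ → ℤ → Set
    IsProperEPDF k λ' μ = IsEPDF k λ' μ × λ' ≢ μ

-- Since P is the disjoint union of the blocks Dᵢ, every ordered pair of distinct
-- elements of P lies in a unique pair of blocks (Dᵢ, Dⱼ), so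
-- Δ(P) = ⋃ᵢ Δ(Dᵢ) + ⋃_{i≠j} Δ(Dᵢ, Dⱼ).  As Δ(P) = σ P + μ (G* \ P), one summand
-- is λ G* exactly when the other is (σ - λ) P + (μ - λ) (G* \ P), and P = S.
-- Properness is σ ≠ μ.

module Submission where

open import Defs
open import Data.Bool using (Bool; true; false; _∧_; not)
open import Data.Bool.Properties using (T-≡; ⇔→≡)
open import Data.Fin using (Fin; _≟_; punchIn) renaming (zero to fzero; suc to fsuc)
open import Data.Fin.Properties using (punchInᵢ≢i)
open import Data.Fin.Subset using (Subset; _∈_; _∉_)
open import Data.Integer using (ℤ; +_; _-_) renaming (_+_ to _+ℤ_; _*_ to _*ℤ_)
open import Data.Integer.Properties using (pos-+; pos-*; i-j≡0⇒i≡j; +-inverseʳ; +-injective)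
open import Data.Integer.Tactic.RingSolver using (solve-∀)
open import Data.List using (allFin; tabulate)
open import Data.List.Membership.Propositional using (lose)
open import Data.List.Membership.Propositional.Properties using (∈-allFin)
open import Data.List.Properties using (map-tabulate)
open import Data.List.Relation.Unary.Any using (satisfied)
open import Data.List.Relation.Unary.Any.Properties using (any⁺; any⁻)
open import Data.Nat using (ℕ; zero; suc; _+_; _*_)
open import Data.Nat.ListAction using () renaming (sum to sumˡ)
open import Data.Nat.Properties using (+-*-semiring; *-identityˡ; +-identityʳ; +-comm)
open import Data.Product using (_×_; ∃; _,_)
open import Algebra.Properties.Semiring.Sum +-*-semiring
  using (sum; sum-syntax; ∑-comm; ∑-distrib-+; sum-cong-≗; sum-remove; sum-replicate-zero;
         *-distribˡ-sum; *-distribʳ-sum)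
open import Data.Vec using (lookup)
open import Data.Vec.Properties using ([]=⇒lookup; lookup⇒[]=)
open import Function.Base using (id; _∘_)
open import Function.Bundles using (_⇔_; Equivalence; mk⇔)
open import Relation.Binary.PropositionalEquality
  using (_≡_; _≢_; refl; sym; trans; cong; cong₂; module ≡-Reasoning)
open import Relation.Nullary using (yes; no; contradiction)
open import Relation.Nullary.Decidable using (⌊_⌋)

Σ≡∑ : ∀ n (f : Fin n → ℕ) → Σ[ n ] f ≡ ∑[ i < n ] f i
Σ≡∑ n f = trans (cong sumˡ (map-tabulate id f)) (sumˡ-tabulate f)
  where
  sumˡ-tabulate : ∀ {n} (f : Fin n → ℕ) → sumˡ (tabulate f) ≡ sum f
  sumˡ-tabulate {zero}  f = refl
  sumˡ-tabulate {suc n} f = cong (_+_ (f fzero)) (sumˡ-tabulate (f ∘ fsuc))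

Σ-cong : ∀ n {f g : Fin n → ℕ} → (∀ i → f i ≡ g i) → Σ[ n ] f ≡ Σ[ n ] g
Σ-cong n {f} {g} f≗g = trans (Σ≡∑ n f) (trans (sum-cong-≗ f≗g) (sym (Σ≡∑ n g)))

∑-zero : ∀ {n} (f : Fin n → ℕ) → (∀ i → f i ≡ 0) → ∑[ i < n ] f i ≡ 0
∑-zero {n} f f≗0 = trans (sum-cong-≗ f≗0) (sum-replicate-zero n)

∑-single : ∀ {n} (f : Fin n → ℕ) (i : Fin n) → (∀ j → j ≢ i → f j ≡ 0) →
           ∑[ j < n ] f j ≡ f i
∑-single {suc n} f i vanishes = begin
  sum f                      ≡⟨ sum-remove {i = i} f ⟩
  f i + sum (f ∘ punchIn i)  ≡⟨ cong (_+_ (f i)) (∑-zero _ (vanishes _ ∘ punchInᵢ≢i i)) ⟩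
  f i + 0                    ≡⟨ +-identityʳ (f i) ⟩
  f i                        ∎
  where open ≡-Reasoning

∑-comm₃ : ∀ {a b c} (f : Fin a → Fin b → Fin c → ℕ) →
  ∑[ i < a ] ∑[ j < b ] ∑[ k < c ] f i j k ≡ ∑[ j < b ] ∑[ k < c ] ∑[ i < a ] f i j k
∑-comm₃ f = trans (∑-comm (λ i j → ∑[ k < _ ] f i j k))
                  (sum-cong-≗ (λ j → ∑-comm (λ i k → f i j k)))

Σ²≡∑² : ∀ a b (f : Fin a → Fin b → ℕ) →
  Σ[ a ] (λ i → Σ[ b ] (f i)) ≡ ∑[ i < a ] ∑[ j < b ] f i j
Σ²≡∑² a b f = trans (Σ≡∑ a _) (sum-cong-≗ (λ i → Σ≡∑ b (f i)))

ind-∧ : ∀ a b → ind (a ∧ b) ≡ ind a * ind b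
ind-∧ true  b = sym (*-identityˡ (ind b))
ind-∧ false b = refl

ind-∧₃ : ∀ a b c → ind (a ∧ b ∧ c) ≡ ind a * (ind b * ind c)
ind-∧₃ a b c = trans (ind-∧ a (b ∧ c)) (cong (_*_ (ind a)) (ind-∧ b c))

ind-split : ∀ {p} z → (p ≡ true → z ≡ true) → ind z ≡ ind p + ind (z ∧ not p)
ind-split {true}  true  _    = refl
ind-split {true}  false p⇒z with p⇒z refl
... | ()
ind-split {false} true  _    = refl
ind-split {false} false _    = refl

ind-excluded-middle : ∀ b x → x ≡ ind b * x + ind (not b) * x
ind-excluded-middle true  x = sym (trans (+-identityʳ _) (+-identityʳ x))
ind-excluded-middle false x = sym (+-identityʳ x)

∑-split-diagonal : ∀ {m} (h : Fin m → Fin m → ℕ) →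
  ∑[ i < m ] ∑[ j < m ] h i j
    ≡ ∑[ i < m ] h i i + ∑[ i < m ] ∑[ j < m ] (ind (not ⌊ i ≟ j ⌋) * h i j)
∑-split-diagonal {m} h =
  trans (sum-cong-≗ row) (∑-distrib-+ (λ i → h i i) (λ i → ∑[ j < m ] (ind (not ⌊ i ≟ j ⌋) * h i j)))
  where
  on-diagonal : ∀ i → ind ⌊ i ≟ i ⌋ * h i i ≡ h i i
  on-diagonal i with i ≟ i
  ... | yes _  = *-identityˡ (h i i)
  ... | no i≢i = contradiction refl i≢i

  off-diagonal : ∀ i j → j ≢ i → ind ⌊ i ≟ j ⌋ * h i j ≡ 0
  off-diagonal i j j≢i with i ≟ j
  ... | yes refl = contradiction refl j≢i
  ... | no _     = refl

  row : ∀ i → ∑[ j < m ] h i j ≡ h i i + ∑[ j < m ] (ind (not ⌊ i ≟ j ⌋) * h i j)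
  row i = begin
    ∑[ j < m ] h i j
      ≡⟨ sum-cong-≗ (λ j → ind-excluded-middle ⌊ i ≟ j ⌋ (h i j)) ⟩
    ∑[ j < m ] (ind ⌊ i ≟ j ⌋ * h i j + ind (not ⌊ i ≟ j ⌋) * h i j)
      ≡⟨ ∑-distrib-+ (λ j → ind ⌊ i ≟ j ⌋ * h i j) (λ j → ind (not ⌊ i ≟ j ⌋) * h i j) ⟩
    ∑[ j < m ] (ind ⌊ i ≟ j ⌋ * h i j) + ∑[ j < m ] (ind (not ⌊ i ≟ j ⌋) * h i j)
      ≡⟨ cong₂ _+_ (trans (∑-single _ i (off-diagonal i)) (on-diagonal i)) refl ⟩
    h i i + ∑[ j < m ] (ind (not ⌊ i ≟ j ⌋) * h i j)
      ∎
    where open ≡-Reasoning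

module _ {n : ℕ} {A : Subset n} {x : Fin n} where

  lookup⇒∈ : lookup A x ≡ true → x ∈ A
  lookup⇒∈ = lookup⇒[]= x A

  ∉⇒lookup : x ∉ A → lookup A x ≡ false
  ∉⇒lookup x∉A with lookup A x in x∈A
  ... | true  = contradiction (lookup⇒∈ x∈A) x∉A
  ... | false = refl

module _ {n : ℕ} (G : FinGroup n) where
  open FinGroup G

  -- Δ⁺ A A is definitionally Δ A.
  Δ⁺ : Subset n → Subset n → Fin n → ℕ
  Δ⁺ A B g = Σ[ n ] λ x → Σ[ n ] λ y →
    ind (mem G A x ∧ mem G B y ∧ not (eqᵇ G x y) ∧ eqᵇ G (x ⊝ y) g)

  Δ⁺-disjoint : ∀ {A B} → (∀ x → x ∈ A → x ∉ B) → ∀ g → Δ⁺ A B g ≡ Δ₂ G A B g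
  Δ⁺-disjoint {A} {B} disjoint g = Σ-cong n (λ x → Σ-cong n (λ y → distinct x y))
    where
    distinct : ∀ x y → ind (mem G A x ∧ mem G B y ∧ not (eqᵇ G x y) ∧ eqᵇ G (x ⊝ y) g)
                     ≡ ind (mem G A x ∧ mem G B y ∧ eqᵇ G (x ⊝ y) g)
    distinct x y with mem G A x in x∈A | mem G B y in y∈B | x ≟ y
    ... | true  | true  | yes refl = contradiction (lookup⇒∈ y∈B) (disjoint x (lookup⇒∈ x∈A))
    ... | true  | true  | no _     = refl
    ... | true  | false | _        = refl
    ... | false | _     | _        = refl

module _ {n m : ℕ} (G : FinGroup n) {P : Subset n} {D : Fin m → Subset n}
  (disjoint : ∀ i j → i ≢ j → ∀ x → x ∈ D i → x ∉ D j)
  (partition : ∀ x → x ∈ P ⇔ ∃ λ i → x ∈ D i) where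
  open FinGroup G
  open Equivalence

  count-blocks : ∀ x → ∑[ i < m ] ind (mem G (D i) x) ≡ ind (mem G P x)
  count-blocks x with mem G P x in P[x]
  ... | true  with to (partition x) (lookup⇒∈ P[x])
  ...   | i , x∈Dᵢ = trans (∑-single _ i outside) (cong ind ([]=⇒lookup x∈Dᵢ))
    where
    outside : ∀ j → j ≢ i → ind (mem G (D j) x) ≡ 0
    outside j j≢i = cong ind (∉⇒lookup (λ x∈Dⱼ → disjoint j i j≢i x x∈Dⱼ x∈Dᵢ))
  count-blocks x | false = ∑-zero _ nowhere
    where
    nowhere : ∀ i → ind (mem G (D i) x) ≡ 0
    nowhere i = cong ind (∉⇒lookup (λ x∈Dᵢ →
      contradiction (trans (sym ([]=⇒lookup (from (partition x) (i , x∈Dᵢ)))) P[x]) λ ()))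

  memS≡mem : ∀ g → memS G D g ≡ mem G P g
  memS≡mem g = ⇔→≡ {z = true} (mk⇔ in-block⇒in-P in-P⇒in-block)
    where
    in-block⇒in-P : memS G D g ≡ true → mem G P g ≡ true
    in-block⇒in-P g∈S with satisfied (any⁻ _ (allFin m) (from T-≡ g∈S))
    ... | i , g∈Dᵢ = []=⇒lookup (from (partition g) (i , lookup⇒∈ (to T-≡ g∈Dᵢ)))
    in-P⇒in-block : mem G P g ≡ true → memS G D g ≡ true
    in-P⇒in-block g∈P with to (partition g) (lookup⇒∈ g∈P)
    ... | i , g∈Dᵢ = to T-≡ (any⁺ _ (lose (∈-allFin i) (from T-≡ ([]=⇒lookup g∈Dᵢ))))

  pair-in-blocks : ∀ x y c → ind (mem G P x ∧ mem G P y ∧ c)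
    ≡ ∑[ i < m ] ∑[ j < m ] ind (mem G (D i) x ∧ mem G (D j) y ∧ c)
  pair-in-blocks x y c = begin
    ind (mem G P x ∧ mem G P y ∧ c)
      ≡⟨ ind-∧₃ (mem G P x) (mem G P y) c ⟩
    ind (mem G P x) * (ind (mem G P y) * ind c)
      ≡⟨ cong₂ (λ s t → s * (t * ind c)) (sym (count-blocks x)) (sym (count-blocks y)) ⟩
    (∑[ i < m ] a i) * ((∑[ j < m ] b j) * ind c)
      ≡⟨ *-distribʳ-sum _ a ⟩
    ∑[ i < m ] (a i * ((∑[ j < m ] b j) * ind c))
      ≡⟨ sum-cong-≗ (λ i → cong (_*_ (a i)) (*-distribʳ-sum (ind c) b)) ⟩
    ∑[ i < m ] (a i * ∑[ j < m ] (b j * ind c))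
      ≡⟨ sum-cong-≗ (λ i → *-distribˡ-sum (a i) (λ j → b j * ind c)) ⟩
    ∑[ i < m ] ∑[ j < m ] (a i * (b j * ind c))
      ≡⟨ sum-cong-≗ (λ i → sum-cong-≗ (λ j → sym (ind-∧₃ (mem G (D i) x) (mem G (D j) y) c))) ⟩
    ∑[ i < m ] ∑[ j < m ] ind (mem G (D i) x ∧ mem G (D j) y ∧ c)
      ∎
    where
    open ≡-Reasoning
    a b : Fin m → ℕ
    a i = ind (mem G (D i) x)
    b j = ind (mem G (D j) y)

  Δ-bilinear : ∀ g → Δ G P g ≡ ∑[ i < m ] ∑[ j < m ] Δ⁺ G (D i) (D j) g
  Δ-bilinear g = begin
    Δ G P g
      ≡⟨ Σ²≡∑² n n _ ⟩
    ∑[ x < n ] ∑[ y < n ] ind (mem G P x ∧ mem G P y ∧ r x y)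
      ≡⟨ sum-cong-≗ (λ x → sum-cong-≗ (λ y → pair-in-blocks x y (r x y))) ⟩
    ∑[ x < n ] ∑[ y < n ] ∑[ i < m ] ∑[ j < m ] h i j x y
      ≡⟨ sym (∑-comm₃ (λ i x y → ∑[ j < m ] h i j x y)) ⟩
    ∑[ i < m ] ∑[ x < n ] ∑[ y < n ] ∑[ j < m ] h i j x y
      ≡⟨ sum-cong-≗ (λ i → sym (∑-comm₃ (h i))) ⟩
    ∑[ i < m ] ∑[ j < m ] ∑[ x < n ] ∑[ y < n ] h i j x y
      ≡⟨ sum-cong-≗ (λ i → sum-cong-≗ (λ j → sym (Σ²≡∑² n n (h i j)))) ⟩
    ∑[ i < m ] ∑[ j < m ] Δ⁺ G (D i) (D j) g
      ∎
    where
    open ≡-Reasoning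
    r : Fin n → Fin n → Bool
    r x y = not (eqᵇ G x y) ∧ eqᵇ G (x ⊝ y) g
    h : Fin m → Fin m → Fin n → Fin n → ℕ
    h i j x y = ind (mem G (D i) x ∧ mem G (D j) y ∧ r x y)

  Δ-partition : ∀ g → Δ G P g ≡ ΔInt G D g + ΔExt G D g
  Δ-partition g = begin
    Δ G P g
      ≡⟨ Δ-bilinear g ⟩
    ∑[ i < m ] ∑[ j < m ] Δ⁺ G (D i) (D j) g
      ≡⟨ ∑-split-diagonal (λ i j → Δ⁺ G (D i) (D j) g) ⟩
    ∑[ i < m ] Δ G (D i) g + ∑[ i < m ] ∑[ j < m ] (ind (not ⌊ i ≟ j ⌋) * Δ⁺ G (D i) (D j) g)
      ≡⟨ cong₂ _+_ (sym (Σ≡∑ m _)) (sum-cong-≗ (λ i → sum-cong-≗ (off-diagonal i))) ⟩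
    ΔInt G D g + ∑[ i < m ] ∑[ j < m ] (ind (not ⌊ i ≟ j ⌋) * Δ₂ G (D i) (D j) g)
      ≡⟨ cong (_+_ (ΔInt G D g)) (sym (Σ²≡∑² m m _)) ⟩
    ΔInt G D g + ΔExt G D g
      ∎
    where
    open ≡-Reasoning
    off-diagonal : ∀ i j → ind (not ⌊ i ≟ j ⌋) * Δ⁺ G (D i) (D j) g
                         ≡ ind (not ⌊ i ≟ j ⌋) * Δ₂ G (D i) (D j) g
    off-diagonal i j with i ≟ j
    ... | yes _   = refl
    ... | no  i≢j = cong (_*_ 1) (Δ⁺-disjoint G (disjoint i j i≢j) g)

x≡x+y-z⇔y≡z : ∀ (x y z : ℤ) → (x ≡ (x +ℤ y) - z) ⇔ (y ≡ z)
x≡x+y-z⇔y≡z x y z = mk⇔ cancel (λ { refl → x≡x+y-y x y })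
  where
  x≡x+y-y : ∀ x y → x ≡ (x +ℤ y) - y
  x≡x+y-y = solve-∀
  y-z≡x+y-z-x : ∀ x y z → y - z ≡ ((x +ℤ y) - z) - x
  y-z≡x+y-z-x = solve-∀
  cancel : x ≡ (x +ℤ y) - z → y ≡ z
  cancel h = i-j≡0⇒i≡j y z (begin
    y - z                ≡⟨ y-z≡x+y-z-x x y z ⟩
    ((x +ℤ y) - z) - x   ≡⟨ cong (_- x) (sym h) ⟩
    x - x                ≡⟨ +-inverseʳ x ⟩
    + 0                  ∎)
    where open ≡-Reasoning

partial-parameters : ∀ {X Y σ μ λ' p q : ℕ} → X + Y ≡ σ * p + μ * q →
  (Y ≡ λ' * (p + q)) ⇔ (+ X ≡ ((+ σ - + λ') *ℤ + p) +ℤ ((+ μ - + λ') *ℤ + q))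
partial-parameters {X} {Y} {σ} {μ} {λ'} {p} {q} split =
  mk⇔ (λ Y≡ → trans (from shift (cong (+_) Y≡)) (sym rhs))
      (λ X≡ → +-injective (to shift (trans X≡ rhs)))
  where
  open Equivalence
  shift : (+ X ≡ (+ X +ℤ + Y) - + (λ' * (p + q))) ⇔ (+ Y ≡ + (λ' * (p + q)))
  shift = x≡x+y-z⇔y≡z (+ X) (+ Y) (+ (λ' * (p + q)))
  distribute : ∀ s t l a b → ((s - l) *ℤ a) +ℤ ((t - l) *ℤ b) ≡ (s *ℤ a +ℤ t *ℤ b) - l *ℤ (a +ℤ b)
  distribute = solve-∀
  rhs : ((+ σ - + λ') *ℤ + p) +ℤ ((+ μ - + λ') *ℤ + q) ≡ (+ X +ℤ + Y) - + (λ' * (p + q))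
  rhs = begin
    ((+ σ - + λ') *ℤ + p) +ℤ ((+ μ - + λ') *ℤ + q)
      ≡⟨ distribute (+ σ) (+ μ) (+ λ') (+ p) (+ q) ⟩
    (+ σ *ℤ + p +ℤ + μ *ℤ + q) - + λ' *ℤ (+ p +ℤ + q)
      ≡⟨ cong₂ _-_ (sym (trans (pos-+ (σ * p) (μ * q)) (cong₂ _+ℤ_ (pos-* σ p) (pos-* μ q))))
                   (sym (trans (pos-* λ' (p + q)) (cong (_*ℤ_ (+ λ')) (pos-+ p q)))) ⟩
    + (σ * p + μ * q) - + (λ' * (p + q))
      ≡⟨ cong (λ t → + t - + (λ' * (p + q))) (sym split) ⟩
    + (X + Y) - + (λ' * (p + q))
      ≡⟨ cong (_- + (λ' * (p + q))) (pos-+ X Y) ⟩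
    (+ X +ℤ + Y) - + (λ' * (p + q))
      ∎
    where open ≡-Reasoning

-‿cancelʳ-≢ : ∀ {σ μ} λ' → σ ≢ μ → (+ σ - + λ') ≢ (+ μ - + λ')
-‿cancelʳ-≢ {σ} {μ} λ' σ≢μ e = σ≢μ (+-injective (begin
  + σ                   ≡⟨ i≡i-j+j (+ σ) (+ λ') ⟩
  (+ σ - + λ') +ℤ + λ'  ≡⟨ cong (_+ℤ + λ') e ⟩
  (+ μ - + λ') +ℤ + λ'  ≡⟨ sym (i≡i-j+j (+ μ) (+ λ')) ⟩
  + μ                   ∎))
  where
  open ≡-Reasoning
  i≡i-j+j : ∀ i j → i ≡ (i - j) +ℤ j
  i≡i-j+j = solve-∀

module _ {n m : ℕ} (G : FinGroup n) {P : Subset n} {σ μ : ℕ}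
  (pds : ∀ g → Δ G P g ≡ σ * ind (mem G P g) + μ * ind (nonzero G g ∧ not (mem G P g)))
  (0∉P : FinGroup.0g G ∉ P) {D : Fin m → Subset n}
  (disjoint : ∀ i j → i ≢ j → ∀ x → x ∈ D i → x ∉ D j)
  (partition : ∀ x → x ∈ P ⇔ ∃ λ i → x ∈ D i) where
  open FinGroup G

  P⊆G* : ∀ g → mem G P g ≡ true → nonzero G g ≡ true
  P⊆G* g g∈P with g ≟ 0g
  ... | yes refl = contradiction (lookup⇒∈ g∈P) 0∉P
  ... | no _     = refl

  PartialRHS-P : ∀ a b g → PartialRHS G D a b g
    ≡ (a *ℤ + ind (mem G P g)) +ℤ (b *ℤ + ind (nonzero G g ∧ not (mem G P g)))
  PartialRHS-P a b g = cong (λ s → (a *ℤ + ind s) +ℤ (b *ℤ + ind (nonzero G g ∧ not s)))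
                            (memS≡mem G disjoint partition g)

  complementary-parameters : (X Y : Fin n → ℕ) → (∀ g → Δ G P g ≡ X g + Y g) → ∀ λ' →
    (∀ g → Y g ≡ λ' * ind (nonzero G g))
      ⇔ (∀ g → + X g ≡ PartialRHS G D (+ σ - + λ') (+ μ - + λ') g)
  complementary-parameters X Y split λ' =
    mk⇔ (λ h g → Equivalence.to (at g) (h g)) (λ h g → Equivalence.from (at g) (h g))
    where
    at : ∀ g → (Y g ≡ λ' * ind (nonzero G g))
               ⇔ (+ X g ≡ PartialRHS G D (+ σ - + λ') (+ μ - + λ') g)
    at g rewrite ind-split (nonzero G g) (P⊆G* g) | PartialRHS-P (+ σ - + λ') (+ μ - + λ') g =
      partial-parameters {λ' = λ'} {p = ind (mem G P g)} {q = ind (nonzero G g ∧ not (mem G P g))}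
                         (trans (sym (split g)) (pds g))

theorem2p4 : (n m k : ℕ) (G : FinGroup n) (P : Subset n) (σ μ : ℕ)
    → IsPDS G P (m * k) σ μ
    → σ ≢ μ
    → FinGroup.0g G ∉ P
    → (D : Fin m → Subset n)
    → DisjointKSubsets G D k
    → (∀ x → x ∈ P ⇔ ∃ λ i → x ∈ D i)
    → (∀ (λ' : ℕ) → IsEDF G D k λ' ⇔ IsProperDPDF G D k (+ σ - + λ') (+ μ - + λ'))
      × (∀ (λ' : ℕ) → IsDDF G D k λ' ⇔ IsProperEPDF G D k (+ σ - + λ') (+ μ - + λ'))
theorem2p4 n m k G P σ μ (_ , pds) σ≢μ 0∉P D family@(_ , disjoint) partition =
  (λ λ' → mk⇔ (λ (_ , ext) → (family , 0∉D , to (int-ext λ') ext) , -‿cancelʳ-≢ λ' σ≢μ)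
              (λ ((_ , _ , int) , _) → family , from (int-ext λ') int))
  , (λ λ' → mk⇔ (λ (_ , int) → (family , 0∉D , to (ext-int λ') int) , -‿cancelʳ-≢ λ' σ≢μ)
                (λ ((_ , _ , ext) , _) → family , from (ext-int λ') ext))
  where
  open Equivalence
  0∉D : ∀ i → FinGroup.0g G ∉ D i
  0∉D i 0∈Dᵢ = 0∉P (from (partition _) (i , 0∈Dᵢ))
  int-ext : ∀ λ' → (∀ g → ΔExt G D g ≡ λ' * ind (nonzero G g))
                   ⇔ (∀ g → + ΔInt G D g ≡ PartialRHS G D (+ σ - + λ') (+ μ - + λ') g)
  int-ext = complementary-parameters G pds 0∉P disjoint partition (ΔInt G D) (ΔExt G D)
              (Δ-partition G disjoint partition)
  ext-int : ∀ λ' → (∀ g → ΔInt G D g ≡ λ' * ind (nonzero G g))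
                   ⇔ (∀ g → + ΔExt G D g ≡ PartialRHS G D (+ σ - + λ') (+ μ - + λ') g)
  ext-int = complementary-parameters G pds 0∉P disjoint partition (ΔExt G D) (ΔInt G D)
              (λ g → trans (Δ-partition G disjoint partition g) (+-comm (ΔInt G D g) _))
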